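{- Let $G$ be a graph with $\alpha(G)\le \alpha$ (where $\alpha\ge 1$) and let $k\ge 2$ be an integer. If $t_{k-1}(G)>0$, then $$\frac{t_k(G)}{t_{k-1}(G)}\ge \frac{|G|}{k\alpha^{k-1}}-1.$$
   Context: $t_i(G)$ denotes the number of copies of the complete graph $K_i$ in $G$ (so $t_1(G)=|G|$ is the number of vertices); $\alpha(G)$ is the independence number. -}

module Defs where

open import Data.Nat using (ℕ; zero; suc; _<_; _≤_; >-nonZero; _≟_)
open import Data.Integer using (+_)
open import Data.Rational using (ℚ; _/_)
open import Data.Fin using (Fin)
open import Data.Fin.Subset using (Subset; _∈_; ∣_∣; inside; outside)
open import Data.Fin.Subset.Properties using (_∈?_)
open import Data.Fin.Properties using (all?) renaming (_≟_ to _≟F_)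
open import Data.Vec using (_∷_; [])
open import Data.List using (List; []; _∷_; _++_; map; filter; length)
open import Data.Product using (_×_)
open import Relation.Nullary using (¬_; Dec)
open import Relation.Nullary.Decidable using (_×-dec_; _→-dec_; ¬?)
open import Relation.Binary.PropositionalEquality using (_≡_)

record Graph (n : ℕ) : Set₁ where
  field
    Adj     : Fin n → Fin n → Set
    adj?    : ∀ u v → Dec (Adj u v)
    sym     : ∀ {u v} → Adj u v → Adj v u
    irrefl  : ∀ {u} → ¬ Adj u u
open Graph public

∣V∣ : ∀ {n} → Graph n → ℕ
∣V∣ {n} _ = n

IsClique : ∀ {n} → Graph n → Subset n → Set
IsClique G S = ∀ u v → u ∈ S → v ∈ S → ¬ (u ≡ v) → Adj G u v

IsIndependent : ∀ {n} → Graph n → Subset n → Set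
IsIndependent G S = ∀ u v → u ∈ S → v ∈ S → ¬ Adj G u v

isClique? : ∀ {n} (G : Graph n) (S : Subset n) → Dec (IsClique G S)
isClique? G S = all? λ u → all? λ v →
  (u ∈? S) →-dec ((v ∈? S) →-dec ((¬? (u ≟F v)) →-dec adj? G u v))

allSubsets : (n : ℕ) → List (Subset n)
allSubsets zero    = [] ∷ []
allSubsets (suc n) = map (outside ∷_) (allSubsets n) ++ map (inside ∷_) (allSubsets n)

t : ∀ {n} → ℕ → Graph n → ℕ
t {n} i G = length (filter (λ S → isClique? G S ×-dec (∣ S ∣ ≟ i)) (allSubsets n))

IndepNumberAtMost : ∀ {n} → Graph n → ℕ → Set
IndepNumberAtMost G a = ∀ S → IsIndependent G S → ∣ S ∣ ≤ a

frac : ℕ → (d : ℕ) → 0 < d → ℚ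
frac m d d>0 = (+ m) / d where instance _ = >-nonZero d>0

module Submission where

-- Writing t_i for t_i(G) and n = |G|, the statement is the cross-multiplied
-- inequality n t_j ≤ (j+1) α^j (t_{j+1} + t_j), proved for all j by induction.
-- For a set L let ext L be the set of vertices v ∉ L with L ∪ {v} an (i+1)-clique.
-- Double counting the pairs (L, v) gives, summing over the i-cliques L,
--   ∑ |ext L| = (i+1) t_{i+1}   and   ∑ degSum(G[ext L]) = (i+1)(i+2) t_{i+2},
-- because the neighbours of v inside ext L are exactly the extensions of L ∪ {v}.
-- Since α(G[ext L]) ≤ α, a greedy Turán-type bound gives
-- |ext L|² ≤ α (degSum(G[ext L]) + |ext L|), and Cauchy–Schwarz over the
-- i-cliques yields ((i+1) t_{i+1})² ≤ t_i α ((i+1)(i+2) t_{i+2} + (i+1) t_{i+1}),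
-- from which the induction step is arithmetic.

open import Defs hiding (sym)
open import Data.Nat using (ℕ; _≤_; _<_; _*_; _^_; _∸_)
open import Data.Rational using (_-_; 1ℚ) renaming (_≤_ to _≤ℚ_)

open import Data.Nat as ℕ using (zero; suc; _+_; z≤n; s≤s; NonZero; >-nonZero)
open import Data.Nat.Properties hiding (_≟_)
open import Data.Nat.Tactic.RingSolver using (solve-∀)
open import Data.Fin using (Fin; zero; suc; _≟_)
open import Data.Fin.Properties using (any?)
open import Data.Fin.Subset using (Subset; inside; outside; _∈_; _⊆_; ∣_∣; ⁅_⁆; ⊤; Empty)
open import Data.Fin.Subset.Properties
  using (_∈?_; nonempty?; Empty-unique; ∣⊥∣≡0; ∣⊤∣≡n; ∣p∣≤n; p⊆q⇒∣p∣≤∣q∣; ∣⁅x⁆∣≡1; x∈⁅y⁆⇒x≡y)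
open import Data.Bool using (Bool; true; false; not; _∧_)
open import Data.Product using (_×_; _,_; proj₁; proj₂; ∃)
open import Data.Sum using (_⊎_; inj₁; inj₂)
open import Data.Vec using ([]; _∷_; lookup; tabulate; _[_]≔_)
open import Data.Vec.Properties using ([]=⇒lookup; lookup⇒[]=; lookup∘updateAt; lookup∘updateAt′; lookup∘tabulate)
open import Data.List using (List; []; _∷_; _++_; map; filter; length)
open import Function using (_∘_)
open import Relation.Nullary using (Dec; yes; no; does; ¬_; contradiction)
open import Relation.Nullary.Decidable using (_×-dec_; dec-true)
open import Relation.Binary.PropositionalEquality
open import Algebra.Properties.Semiring.Sum +-*-semiring
  using (sum; sum-syntax; sum-cong-≗; sum-replicate-zero; ∑-distrib-+; *-distribˡ-sum; *-distribʳ-sum)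
import Data.Integer as ℤ
import Data.Integer.Properties as ℤ
open import Data.Rational using (_/_; -_) renaming (_+_ to _+ℚ_)
import Data.Rational.Properties as ℚ
open import Data.Rational.Unnormalised using (mkℚᵘ; 1ℚᵘ; *≤*)
import Data.Rational.Unnormalised.Properties as ℚᵘ

bit : Bool → ℕ
bit true  = 1
bit false = 0

⟦_⟧ : ∀ {p} {P : Set p} → Dec P → ℕ
⟦ yes _ ⟧ = 1
⟦ no  _ ⟧ = 0

⟦⟧-× : ∀ {p q} {P : Set p} {Q : Set q} (P? : Dec P) (Q? : Dec Q) → ⟦ P? ×-dec Q? ⟧ ≡ ⟦ P? ⟧ * ⟦ Q? ⟧
⟦⟧-× (yes _) (yes _) = refl
⟦⟧-× (yes _) (no  _) = refl
⟦⟧-× (no  _) _       = refl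

bit-not-∧-does : ∀ {p} {P : Set p} b (P? : Dec P) → bit (not b ∧ does P?) ≡ bit (not b) * ⟦ P? ⟧
bit-not-∧-does true  _       = refl
bit-not-∧-does false (yes _) = refl
bit-not-∧-does false (no  _) = refl

⟦⟧-⇔ : ∀ {p q} {P : Set p} {Q : Set q} → (P → Q) → (Q → P) → (P? : Dec P) (Q? : Dec Q) → ⟦ P? ⟧ ≡ ⟦ Q? ⟧
⟦⟧-⇔ P→Q Q→P (yes p) (yes q) = refl
⟦⟧-⇔ P→Q Q→P (yes p) (no ¬q) = contradiction (P→Q p) ¬q
⟦⟧-⇔ P→Q Q→P (no ¬p) (yes q) = contradiction (Q→P q) ¬p
⟦⟧-⇔ P→Q Q→P (no ¬p) (no ¬q) = refl

sum-mono : ∀ {n} {f g : Fin n → ℕ} → (∀ i → f i ≤ g i) → sum f ≤ sum g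
sum-mono {zero}  f≤g = z≤n
sum-mono {suc n} f≤g = +-mono-≤ (f≤g zero) (sum-mono (f≤g ∘ suc))

sum-pick : ∀ {n} (v : Fin n) (f : Fin n → ℕ) → ∑[ u < n ] (f u * ⟦ u ≟ v ⟧) ≡ f v
sum-pick {suc n} zero f = begin
  f zero * 1 + ∑[ u < n ] (f (suc u) * 0) ≡⟨ cong₂ _+_ (*-identityʳ (f zero)) (sum-cong-≗ (*-zeroʳ ∘ f ∘ suc)) ⟩
  f zero + ∑[ u < n ] 0                  ≡⟨ cong (f zero +_) (sum-replicate-zero n) ⟩
  f zero + 0                             ≡⟨ +-identityʳ (f zero) ⟩
  f zero                                 ∎
  where open ≡-Reasoning
sum-pick {suc n} (suc v) f = begin
  f zero * 0 + ∑[ u < n ] (f (suc u) * ⟦ suc u ≟ suc v ⟧) ≡⟨ cong₂ _+_ (*-zeroʳ (f zero)) (sum-cong-≗ (cong (f (suc _) *_) ∘ pick-suc)) ⟩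
  ∑[ u < n ] (f (suc u) * ⟦ u ≟ v ⟧)                    ≡⟨ sum-pick v (f ∘ suc) ⟩
  f (suc v)                                               ∎
  where
  open ≡-Reasoning
  pick-suc : ∀ u → ⟦ suc u ≟ suc v ⟧ ≡ ⟦ u ≟ v ⟧
  pick-suc u with u ≟ v
  ... | yes _ = refl
  ... | no  _ = refl

∈⇒lookup : ∀ {n} {u : Fin n} {L : Subset n} → u ∈ L → lookup L u ≡ true
∈⇒lookup = []=⇒lookup

lookup⇒∈ : ∀ {n} {u : Fin n} {L : Subset n} → lookup L u ≡ true → u ∈ L
lookup⇒∈ {u = u} {L} = lookup⇒[]= u L

lookup⇒∉ : ∀ {n} {u : Fin n} {L : Subset n} → lookup L u ≡ false → ¬ u ∈ L
lookup⇒∉ u∉L u∈L with trans (sym u∉L) (∈⇒lookup u∈L)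
... | ()

χ∈ χ∉ : ∀ {n} → Subset n → Fin n → ℕ
χ∈ L v = bit (lookup L v)
χ∉ L v = bit (not (lookup L v))

⁅⁆⊆ : ∀ {n} {x : Fin n} {S} → x ∈ S → ⁅ x ⁆ ⊆ S
⁅⁆⊆ {x = x} {S} x∈S y∈⁅x⁆ = subst (_∈ S) (sym (x∈⁅y⁆⇒x≡y x y∈⁅x⁆)) x∈S

∈⇒∣∣≥1 : ∀ {n} {x : Fin n} {S} → x ∈ S → 1 ≤ ∣ S ∣
∈⇒∣∣≥1 {x = x} x∈S = subst (_≤ _) (∣⁅x⁆∣≡1 x) (p⊆q⇒∣p∣≤∣q∣ (⁅⁆⊆ x∈S))

∣∣≡∑χ∈ : ∀ {n} (S : Subset n) → ∣ S ∣ ≡ ∑[ v < n ] χ∈ S v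
∣∣≡∑χ∈ []          = refl
∣∣≡∑χ∈ (true ∷ S)  = cong suc (∣∣≡∑χ∈ S)
∣∣≡∑χ∈ (false ∷ S) = ∣∣≡∑χ∈ S

_⊕_ : ∀ {n} → Subset n → Fin n → Subset n
L ⊕ v = L [ v ]≔ inside

⊕-here : ∀ {n} (L : Subset n) v → lookup (L ⊕ v) v ≡ true
⊕-here L v = lookup∘updateAt v L

⊕-there : ∀ {n} (L : Subset n) {u v} → ¬ u ≡ v → lookup (L ⊕ v) u ≡ lookup L u
⊕-there L {u} {v} u≢v = lookup∘updateAt′ u v u≢v L

∣⊕∣ : ∀ {n} (L : Subset n) v → lookup L v ≡ false → ∣ L ⊕ v ∣ ≡ suc ∣ L ∣
∣⊕∣ (false ∷ L) zero    refl = refl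
∣⊕∣ (true  ∷ L) (suc v) v∉L  = cong suc (∣⊕∣ L v v∉L)
∣⊕∣ (false ∷ L) (suc v) v∉L  = ∣⊕∣ L v v∉L

∈-⊕-here : ∀ {n} (L : Subset n) v → v ∈ L ⊕ v
∈-⊕-here L v = lookup⇒∈ (⊕-here L v)

∈-⊕⁺ : ∀ {n} (L : Subset n) v {u} → u ∈ L → u ∈ L ⊕ v
∈-⊕⁺ L v {u} u∈L with u ≟ v
... | yes refl = ∈-⊕-here L u
... | no  u≢v  = lookup⇒∈ (trans (⊕-there L u≢v) (∈⇒lookup u∈L))

∈-⊕⁻ : ∀ {n} (L : Subset n) v {u} → u ∈ L ⊕ v → u ≡ v ⊎ u ∈ L
∈-⊕⁻ L v {u} u∈L⊕v with u ≟ v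
... | yes u≡v = inj₁ u≡v
... | no  u≢v = inj₂ (lookup⇒∈ (trans (sym (⊕-there L u≢v)) (∈⇒lookup u∈L⊕v)))

∑ˢ : (n : ℕ) → (Subset n → ℕ) → ℕ
∑ˢ zero    f = f []
∑ˢ (suc n) f = ∑ˢ n (f ∘ (outside ∷_)) + ∑ˢ n (f ∘ (inside ∷_))

∑ˢ-cong : ∀ n {f g : Subset n → ℕ} → (∀ S → f S ≡ g S) → ∑ˢ n f ≡ ∑ˢ n g
∑ˢ-cong zero    f≗g = f≗g []
∑ˢ-cong (suc n) f≗g = cong₂ _+_ (∑ˢ-cong n (f≗g ∘ (outside ∷_))) (∑ˢ-cong n (f≗g ∘ (inside ∷_)))

∑ˢ-mono : ∀ n {f g : Subset n → ℕ} → (∀ S → f S ≤ g S) → ∑ˢ n f ≤ ∑ˢ n g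
∑ˢ-mono zero    f≤g = f≤g []
∑ˢ-mono (suc n) f≤g = +-mono-≤ (∑ˢ-mono n (f≤g ∘ (outside ∷_))) (∑ˢ-mono n (f≤g ∘ (inside ∷_)))

∑ˢ-zero : ∀ n → ∑ˢ n (λ _ → 0) ≡ 0
∑ˢ-zero zero    = refl
∑ˢ-zero (suc n) = cong₂ _+_ (∑ˢ-zero n) (∑ˢ-zero n)

∑ˢ-distrib-+ : ∀ n (f g : Subset n → ℕ) → ∑ˢ n (λ S → f S + g S) ≡ ∑ˢ n f + ∑ˢ n g
∑ˢ-distrib-+ zero    f g = refl
∑ˢ-distrib-+ (suc n) f g rewrite ∑ˢ-distrib-+ n (f ∘ (outside ∷_)) (g ∘ (outside ∷_))
                               | ∑ˢ-distrib-+ n (f ∘ (inside ∷_)) (g ∘ (inside ∷_)) =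
  interchange (∑ˢ n (f ∘ (outside ∷_))) (∑ˢ n (g ∘ (outside ∷_))) (∑ˢ n (f ∘ (inside ∷_))) (∑ˢ n (g ∘ (inside ∷_)))
  where
  interchange : ∀ a b c d → a + b + (c + d) ≡ a + c + (b + d)
  interchange = solve-∀

∑ˢ-distribˡ-* : ∀ n c (f : Subset n → ℕ) → ∑ˢ n (λ S → c * f S) ≡ c * ∑ˢ n f
∑ˢ-distribˡ-* zero    c f = refl
∑ˢ-distribˡ-* (suc n) c f = trans (cong₂ _+_ (∑ˢ-distribˡ-* n c (f ∘ (outside ∷_))) (∑ˢ-distribˡ-* n c (f ∘ (inside ∷_))))
                                  (sym (*-distribˡ-+ c _ _))

∑ˢ-comm : ∀ n m (f : Subset n → Fin m → ℕ) → ∑ˢ n (λ S → ∑[ v < m ] f S v) ≡ ∑[ v < m ] ∑ˢ n (λ S → f S v)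
∑ˢ-comm zero    m f = refl
∑ˢ-comm (suc n) m f = trans (cong₂ _+_ (∑ˢ-comm n m (f ∘ (outside ∷_))) (∑ˢ-comm n m (f ∘ (inside ∷_))))
                            (sym (∑-distrib-+ (λ v → ∑ˢ n (λ S → f (outside ∷ S) v)) (λ v → ∑ˢ n (λ S → f (inside ∷ S) v))))

-- For a fixed v, L ↦ L ⊕ v is a bijection from the subsets avoiding v
-- onto the subsets containing v.
∑ˢ-⊕ : ∀ n (v : Fin n) (h : Subset n → ℕ) →
  ∑ˢ n (λ L → χ∉ L v * h (L ⊕ v)) ≡ ∑ˢ n (λ K → χ∈ K v * h K)
∑ˢ-⊕ (suc n) zero h = begin
  H + ∑ˢ n (λ _ → 0)  ≡⟨ cong (H +_) (∑ˢ-zero n) ⟩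
  H + 0              ≡⟨ +-comm H 0 ⟩
  0 + H              ≡⟨ cong (_+ H) (sym (∑ˢ-zero n)) ⟩
  ∑ˢ n (λ _ → 0) + H  ∎
  where
  open ≡-Reasoning
  H = ∑ˢ n (λ K → h (inside ∷ K) + 0)
∑ˢ-⊕ (suc n) (suc v) h = cong₂ _+_ (∑ˢ-⊕ n v (h ∘ (outside ∷_))) (∑ˢ-⊕ n v (h ∘ (inside ∷_)))

-- Double counting: pairs (L, v) with v ∉ L correspond to sets K = L ⊕ v
-- with a marked element, so each K is counted ∣ K ∣ times.
double-count : ∀ n (h : Subset n → ℕ) →
  ∑ˢ n (λ L → ∑[ v < n ] (χ∉ L v * h (L ⊕ v))) ≡ ∑ˢ n (λ K → ∣ K ∣ * h K)
double-count n h = begin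
  ∑ˢ n (λ L → ∑[ v < n ] (χ∉ L v * h (L ⊕ v)))  ≡⟨ ∑ˢ-comm n n _ ⟩
  ∑[ v < n ] ∑ˢ n (λ L → χ∉ L v * h (L ⊕ v))    ≡⟨ sum-cong-≗ (λ v → ∑ˢ-⊕ n v h) ⟩
  ∑[ v < n ] ∑ˢ n (λ K → χ∈ K v * h K)          ≡⟨ sym (∑ˢ-comm n n _) ⟩
  ∑ˢ n (λ K → ∑[ v < n ] (χ∈ K v * h K))        ≡⟨ ∑ˢ-cong n size ⟩
  ∑ˢ n (λ K → ∣ K ∣ * h K)                      ∎
  where
  open ≡-Reasoning
  size : ∀ K → ∑[ v < n ] (χ∈ K v * h K) ≡ ∣ K ∣ * h K
  size K = trans (sym (*-distribʳ-sum (h K) (χ∈ K))) (cong (_* h K) (sym (∣∣≡∑χ∈ K)))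

sumList : ∀ {A : Set} → (A → ℕ) → List A → ℕ
sumList f []       = 0
sumList f (x ∷ xs) = f x + sumList f xs

length-filter-sum : ∀ {A : Set} {P : A → Set} (P? : ∀ x → Dec (P x)) xs →
  length (filter P? xs) ≡ sumList (λ x → ⟦ P? x ⟧) xs
length-filter-sum P? []       = refl
length-filter-sum P? (x ∷ xs) with P? x
... | yes _ = cong suc (length-filter-sum P? xs)
... | no  _ = length-filter-sum P? xs

sumList-++ : ∀ {A : Set} (f : A → ℕ) xs ys → sumList f (xs ++ ys) ≡ sumList f xs + sumList f ys
sumList-++ f []       ys = refl
sumList-++ f (x ∷ xs) ys = trans (cong (f x +_) (sumList-++ f xs ys)) (sym (+-assoc (f x) _ _))

sumList-map : ∀ {A B : Set} (f : B → ℕ) (g : A → B) xs → sumList f (map g xs) ≡ sumList (f ∘ g) xs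
sumList-map f g []       = refl
sumList-map f g (x ∷ xs) = cong (f (g x) +_) (sumList-map f g xs)

sumList-allSubsets : ∀ n (f : Subset n → ℕ) → sumList f (allSubsets n) ≡ ∑ˢ n f
sumList-allSubsets zero    f = +-identityʳ (f [])
sumList-allSubsets (suc n) f = begin
  sumList f (map (outside ∷_) (allSubsets n) ++ map (inside ∷_) (allSubsets n))
    ≡⟨ sumList-++ f (map (outside ∷_) (allSubsets n)) _ ⟩
  sumList f (map (outside ∷_) (allSubsets n)) + sumList f (map (inside ∷_) (allSubsets n))
    ≡⟨ cong₂ _+_ (sumList-map f _ (allSubsets n)) (sumList-map f _ (allSubsets n)) ⟩
  sumList (f ∘ (outside ∷_)) (allSubsets n) + sumList (f ∘ (inside ∷_)) (allSubsets n)
    ≡⟨ cong₂ _+_ (sumList-allSubsets n _) (sumList-allSubsets n _) ⟩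
  ∑ˢ (suc n) f ∎
  where open ≡-Reasoning

am-gm-≤ : ∀ {x y} → x ≤ y → 2 * (x * y) ≤ x * x + y * y
am-gm-≤ {x} {y} x≤y = subst (λ y → 2 * (x * y) ≤ x * x + y * y) (m+[n∸m]≡n x≤y) (gap x (y ∸ x))
  where
  expand : ∀ x d → 2 * (x * (x + d)) + d * d ≡ x * x + (x + d) * (x + d)
  expand = solve-∀
  gap : ∀ x d → 2 * (x * (x + d)) ≤ x * x + (x + d) * (x + d)
  gap x d = subst (2 * (x * (x + d)) ≤_) (expand x d) (m≤m+n _ (d * d))

am-gm : ∀ x y → 2 * (x * y) ≤ x * x + y * y
am-gm x y with ≤-total x y
... | inj₁ x≤y = am-gm-≤ x≤y
... | inj₂ y≤x = subst₂ _≤_ (cong (2 *_) (*-comm y x)) (+-comm (y * y) (x * x)) (am-gm-≤ y≤x)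

square-≤⁻¹ : ∀ a b → a * a ≤ b * b → a ≤ b
square-≤⁻¹ a b a²≤b² with ≤-<-connex a b
... | inj₁ a≤b = a≤b
... | inj₂ b<a = contradiction a²≤b² (<⇒≱ (*-mono-< b<a b<a))

four-mul-≤-square : ∀ x y → 4 * (x * y) ≤ (x + y) * (x + y)
four-mul-≤-square x y = subst₂ _≤_ (four x y) (square x y) (+-monoˡ-≤ (2 * (x * y)) (am-gm x y))
  where
  four : ∀ x y → 2 * (x * y) + 2 * (x * y) ≡ 4 * (x * y)
  four = solve-∀
  square : ∀ x y → x * x + y * y + 2 * (x * y) ≡ (x + y) * (x + y)
  square = solve-∀

-- The cross term satisfies 2p₁p₂ ≤ w₁q₂ + w₂q₁ because its square is
-- at most 4(w₁q₂)(w₂q₁).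
cauchy-schwarz-+ : ∀ p₁ p₂ w₁ w₂ q₁ q₂ → p₁ * p₁ ≤ w₁ * q₁ → p₂ * p₂ ≤ w₂ * q₂ →
  (p₁ + p₂) * (p₁ + p₂) ≤ (w₁ + w₂) * (q₁ + q₂)
cauchy-schwarz-+ p₁ p₂ w₁ w₂ q₁ q₂ h₁ h₂ = begin
  (p₁ + p₂) * (p₁ + p₂)                           ≡⟨ expand p₁ p₂ ⟩
  p₁ * p₁ + p₂ * p₂ + 2 * (p₁ * p₂)               ≤⟨ +-mono-≤ (+-mono-≤ h₁ h₂) cross ⟩
  w₁ * q₁ + w₂ * q₂ + (w₁ * q₂ + w₂ * q₁)         ≡⟨ collect w₁ w₂ q₁ q₂ ⟩
  (w₁ + w₂) * (q₁ + q₂)                           ∎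
  where
  open ≤-Reasoning
  expand : ∀ a b → (a + b) * (a + b) ≡ a * a + b * b + 2 * (a * b)
  expand = solve-∀
  collect : ∀ w₁ w₂ q₁ q₂ → w₁ * q₁ + w₂ * q₂ + (w₁ * q₂ + w₂ * q₁) ≡ (w₁ + w₂) * (q₁ + q₂)
  collect = solve-∀
  square-cross : ∀ a b → (2 * (a * b)) * (2 * (a * b)) ≡ 4 * ((a * a) * (b * b))
  square-cross = solve-∀
  regroup : ∀ w₁ q₁ w₂ q₂ → 4 * ((w₁ * q₁) * (w₂ * q₂)) ≡ 4 * ((w₁ * q₂) * (w₂ * q₁))
  regroup = solve-∀
  cross : 2 * (p₁ * p₂) ≤ w₁ * q₂ + w₂ * q₁
  cross = square-≤⁻¹ _ _ (begin
    (2 * (p₁ * p₂)) * (2 * (p₁ * p₂))   ≡⟨ square-cross p₁ p₂ ⟩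
    4 * ((p₁ * p₁) * (p₂ * p₂))         ≤⟨ *-monoʳ-≤ 4 (*-mono-≤ h₁ h₂) ⟩
    4 * ((w₁ * q₁) * (w₂ * q₂))         ≡⟨ regroup w₁ q₁ w₂ q₂ ⟩
    4 * ((w₁ * q₂) * (w₂ * q₁))         ≤⟨ four-mul-≤-square (w₁ * q₂) (w₂ * q₁) ⟩
    (w₁ * q₂ + w₂ * q₁) * (w₁ * q₂ + w₂ * q₁) ∎)

cauchy-schwarz : ∀ n (w x : Subset n → ℕ) →
  ∑ˢ n (λ S → w S * x S) * ∑ˢ n (λ S → w S * x S) ≤ ∑ˢ n w * ∑ˢ n (λ S → w S * (x S * x S))
cauchy-schwarz zero w x = ≤-reflexive (regroup (w []) (x []))
  where
  regroup : ∀ a b → (a * b) * (a * b) ≡ a * (a * (b * b))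
  regroup = solve-∀
cauchy-schwarz (suc n) w x =
  cauchy-schwarz-+ (∑wx wₒ xₒ) (∑wx wᵢ xᵢ) (∑ˢ n wₒ) (∑ˢ n wᵢ) (∑wx² wₒ xₒ) (∑wx² wᵢ xᵢ)
    (cauchy-schwarz n wₒ xₒ) (cauchy-schwarz n wᵢ xᵢ)
  where
  wₒ xₒ wᵢ xᵢ : Subset n → ℕ
  wₒ = w ∘ (outside ∷_)
  xₒ = x ∘ (outside ∷_)
  wᵢ = w ∘ (inside ∷_)
  xᵢ = x ∘ (inside ∷_)
  ∑wx ∑wx² : (Subset n → ℕ) → (Subset n → ℕ) → ℕ
  ∑wx  w′ x′ = ∑ˢ n (λ S → w′ S * x′ S)
  ∑wx² w′ x′ = ∑ˢ n (λ S → w′ S * (x′ S * x′ S))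

-- If s² ≤ aX then 2sp ≤ X + ap²: multiply by a and use AM–GM on s and ap.
cross-term-bound : ∀ a s X p → s * s ≤ a * X → 2 * (s * p) ≤ X + a * (p * p)
cross-term-bound zero s X p s²≤0 with m*n≡0⇒m≡0∨n≡0 s (n≤0⇒n≡0 s²≤0)
... | inj₁ refl = z≤n
... | inj₂ refl = z≤n
cross-term-bound a@(suc _) s X p s²≤aX = *-cancelˡ-≤ a (begin
  a * (2 * (s * p))          ≡⟨ pull a s p ⟩
  2 * (s * (a * p))          ≤⟨ am-gm s (a * p) ⟩
  s * s + (a * p) * (a * p)  ≤⟨ +-monoˡ-≤ _ s²≤aX ⟩
  a * X + (a * p) * (a * p)  ≡⟨ push a X p ⟩
  a * (X + a * (p * p))      ∎)
  where
  open ≤-Reasoning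
  pull : ∀ a s p → a * (2 * (s * p)) ≡ 2 * (s * (a * p))
  pull = solve-∀
  push : ∀ a X p → a * X + (a * p) * (a * p) ≡ a * (X + a * (p * p))
  push = solve-∀

-- The arithmetic of one greedy step of the degree bound below: removing
-- p = δ + 1 vertices and at least pδ from the degree sum, while lowering the
-- independence bound by one, preserves s² ≤ a(D + s).
greedy-step-arith : ∀ a s D′ D δ → s * s ≤ a * (D′ + s) → D′ + suc δ * δ ≤ D →
  (s + suc δ) * (s + suc δ) ≤ suc a * (D + (s + suc δ))
greedy-step-arith a s D′ D δ ih D′≤D = begin
  (s + p) * (s + p)                   ≡⟨ expand s p ⟩
  s * s + 2 * (s * p) + p * p         ≤⟨ +-monoˡ-≤ (p * p) (+-mono-≤ ih (cross-term-bound a s X p ih)) ⟩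
  a * X + (X + a * (p * p)) + p * p   ≡⟨ collect a X p ⟩
  suc a * (X + p * p)                 ≡⟨ cong (suc a *_) (regroup D′ s δ) ⟩
  suc a * (D′ + p * δ + (s + p))      ≤⟨ *-monoʳ-≤ (suc a) (+-monoˡ-≤ (s + p) D′≤D) ⟩
  suc a * (D + (s + p))               ∎
  where
  open ≤-Reasoning
  p = suc δ
  X = D′ + s
  expand : ∀ s p → (s + p) * (s + p) ≡ s * s + 2 * (s * p) + p * p
  expand = solve-∀
  collect : ∀ a X p → a * X + (X + a * (p * p)) + p * p ≡ suc a * (X + p * p)
  collect = solve-∀
  regroup : ∀ D′ s δ → D′ + s + suc δ * suc δ ≡ D′ + suc δ * δ + (s + suc δ)
  regroup = solve-∀

-- A function on a nonempty subset attains its minimum there: descend from v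
-- to an element of smaller value while one exists; m bounds f v.
minimiser : ∀ {n} (f : Fin n → ℕ) (S : Subset n) m {v} → f v ≤ m → v ∈ S →
  ∃ λ w → w ∈ S × (∀ u → u ∈ S → f w ≤ f u)
minimiser f S zero {v} fv≤0 v∈S = v , v∈S , λ u _ → subst (_≤ f u) (sym (n≤0⇒n≡0 fv≤0)) z≤n
minimiser f S (suc m) {v} fv≤m v∈S with any? (λ u → (u ∈? S) ×-dec (suc (f u) ≤? f v))
... | yes (u , u∈S , fu<fv) = minimiser f S m (≤-pred (≤-trans fu<fv fv≤m)) u∈S
... | no  ¬smaller         = v , v∈S , λ u u∈S → ≮⇒≥ (λ fu<fv → ¬smaller (u , u∈S , fu<fv))

∣Empty∣ : ∀ {n} {S : Subset n} → Empty S → ∣ S ∣ ≡ 0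
∣Empty∣ {n} S=∅ = trans (cong ∣_∣ (Empty-unique S=∅)) (∣⊥∣≡0 n)

module DegreeBound {n : ℕ} (G : Graph n) where

  χA : Fin n → Fin n → ℕ
  χA v w = ⟦ adj? G v w ⟧

  deg : Subset n → Fin n → ℕ
  deg S v = ∑[ w < n ] (χ∈ S w * χA v w)

  degSum : Subset n → ℕ
  degSum S = ∑[ v < n ] (χ∈ S v * deg S v)

  IndepWithin : Subset n → ℕ → Set
  IndepWithin S a = ∀ I → (∀ {x} → x ∈ I → x ∈ S) → IsIndependent G I → ∣ I ∣ ≤ a

  _∖N[_] : Subset n → Fin n → Subset n
  S ∖N[ v ] = tabulate (λ u → not (does (u ≟ v)) ∧ (not (does (adj? G v u)) ∧ lookup S u))

  lookup-∖N : ∀ S v u → lookup (S ∖N[ v ]) u ≡ not (does (u ≟ v)) ∧ (not (does (adj? G v u)) ∧ lookup S u)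
  lookup-∖N S v u = lookup∘tabulate _ u

  ∈-∖N⁻ : ∀ S v {u} → u ∈ S ∖N[ v ] → ¬ u ≡ v × ¬ Adj G v u × u ∈ S
  ∈-∖N⁻ S v {u} u∈S′ with trans (sym (lookup-∖N S v u)) (∈⇒lookup u∈S′)
  -- in every other case the left-hand side of this equation is false
  ... | in-lookup with u ≟ v | adj? G v u | lookup S u in u∈S
  ...   | no u≢v | no ¬vu | true = u≢v , ¬vu , lookup⇒∈ u∈S

  χN[_] : Fin n → Subset n → Fin n → ℕ
  χN[ v ] S u = χ∈ S u * (⟦ u ≟ v ⟧ + χA v u)

  χ∈-∖N : ∀ S v u → χ∈ S u ≡ χ∈ (S ∖N[ v ]) u + χN[ v ] S u
  χ∈-∖N S v u rewrite lookup-∖N S v u with u ≟ v | adj? G v u | lookup S u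
  ... | yes _    | _      | false = refl
  ... | no _     | yes _  | false = refl
  ... | no _     | no _   | false = refl
  ... | yes refl | yes vv | true  = contradiction vv (irrefl G)
  ... | yes refl | no _   | true  = refl
  ... | no _     | yes _  | true  = refl
  ... | no _     | no _   | true  = refl

  χ∈-∖N-≤ : ∀ S v u → χ∈ (S ∖N[ v ]) u ≤ χ∈ S u
  χ∈-∖N-≤ S v u = subst (χ∈ (S ∖N[ v ]) u ≤_) (sym (χ∈-∖N S v u)) (m≤m+n _ _)

  ∑χN : ∀ S v → v ∈ S → ∑[ u < n ] χN[ v ] S u ≡ suc (deg S v)
  ∑χN S v v∈S = begin
    ∑[ u < n ] χN[ v ] S u                                     ≡⟨ sum-cong-≗ (λ u → *-distribˡ-+ (χ∈ S u) ⟦ u ≟ v ⟧ (χA v u)) ⟩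
    ∑[ u < n ] (χ∈ S u * ⟦ u ≟ v ⟧ + χ∈ S u * χA v u)          ≡⟨ ∑-distrib-+ (λ u → χ∈ S u * ⟦ u ≟ v ⟧) (λ u → χ∈ S u * χA v u) ⟩
    ∑[ u < n ] (χ∈ S u * ⟦ u ≟ v ⟧) + deg S v                   ≡⟨ cong (_+ deg S v) (sum-pick v (χ∈ S)) ⟩
    χ∈ S v + deg S v                                           ≡⟨ cong (λ b → bit b + deg S v) (∈⇒lookup v∈S) ⟩
    suc (deg S v)                                              ∎
    where open ≡-Reasoning

  ∣∖N∣ : ∀ S v → v ∈ S → ∣ S ∣ ≡ ∣ S ∖N[ v ] ∣ + suc (deg S v)
  ∣∖N∣ S v v∈S = begin
    ∣ S ∣                                                ≡⟨ ∣∣≡∑χ∈ S ⟩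
    ∑[ u < n ] χ∈ S u                                    ≡⟨ sum-cong-≗ (χ∈-∖N S v) ⟩
    ∑[ u < n ] (χ∈ (S ∖N[ v ]) u + χN[ v ] S u)           ≡⟨ ∑-distrib-+ (χ∈ (S ∖N[ v ])) (χN[ v ] S) ⟩
    ∑[ u < n ] χ∈ (S ∖N[ v ]) u + ∑[ u < n ] χN[ v ] S u  ≡⟨ cong₂ _+_ (sym (∣∣≡∑χ∈ (S ∖N[ v ]))) (∑χN S v v∈S) ⟩
    ∣ S ∖N[ v ] ∣ + suc (deg S v)                        ∎
    where open ≡-Reasoning

  -- if v has minimum degree in S, deleting its closed neighbourhood lowers
  -- the degree sum by at least (1 + deg S v) · deg S v: each deleted vertex
  -- had degree ≥ deg S v, and no degree increases
  degSum-∖N : ∀ S v → v ∈ S → (∀ u → u ∈ S → deg S v ≤ deg S u) →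
    degSum (S ∖N[ v ]) + suc (deg S v) * deg S v ≤ degSum S
  degSum-∖N S v v∈S v-min = begin
    degSum S′ + suc δ * δ
      ≡⟨ cong (degSum S′ +_) (trans (cong (_* δ) (sym (∑χN S v v∈S))) (*-distribʳ-sum δ (χN[ v ] S))) ⟩
    ∑[ u < n ] (χ∈ S′ u * deg S′ u) + ∑[ u < n ] (χN[ v ] S u * δ)
      ≤⟨ +-mono-≤ (sum-mono (λ u → *-monoʳ-≤ (χ∈ S′ u) (deg-∖N u))) (sum-mono δ≤deg) ⟩
    ∑[ u < n ] (χ∈ S′ u * deg S u) + ∑[ u < n ] (χN[ v ] S u * deg S u)
      ≡⟨ sym (∑-distrib-+ (λ u → χ∈ S′ u * deg S u) (λ u → χN[ v ] S u * deg S u)) ⟩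
    ∑[ u < n ] (χ∈ S′ u * deg S u + χN[ v ] S u * deg S u)
      ≡⟨ sum-cong-≗ (λ u → trans (sym (*-distribʳ-+ (deg S u) (χ∈ S′ u) (χN[ v ] S u))) (cong (_* deg S u) (sym (χ∈-∖N S v u)))) ⟩
    degSum S ∎
    where
    open ≤-Reasoning
    S′ = S ∖N[ v ]
    δ = deg S v
    deg-∖N : ∀ u → deg S′ u ≤ deg S u
    deg-∖N u = sum-mono (λ w → *-monoˡ-≤ (χA u w) (χ∈-∖N-≤ S v w))
    δ≤deg : ∀ u → χN[ v ] S u * δ ≤ χN[ v ] S u * deg S u
    δ≤deg u with lookup S u in u∈S
    ... | true  = *-monoʳ-≤ (1 * (⟦ u ≟ v ⟧ + χA v u)) (v-min u (lookup⇒∈ u∈S))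
    ... | false = z≤n

  -- a vertex v ∈ S together with an independent set avoiding N[v] is independent
  indep-∖N : ∀ S v a → v ∈ S → IndepWithin S (suc a) → IndepWithin (S ∖N[ v ]) a
  indep-∖N S v a v∈S indep I I⊆S′ I-indep = ≤-pred (subst (_≤ suc a) (∣⊕∣ I v v∉I) (indep (I ⊕ v) I⊕v⊆S I⊕v-indep))
    where
    v∉I : lookup I v ≡ false
    v∉I with lookup I v in v∈I
    ... | false = refl
    ... | true  = contradiction refl (proj₁ (∈-∖N⁻ S v (I⊆S′ (lookup⇒∈ v∈I))))
    ¬adj : ∀ {x} → x ∈ I → ¬ Adj G v x
    ¬adj x∈I = proj₁ (proj₂ (∈-∖N⁻ S v (I⊆S′ x∈I)))
    I⊕v⊆S : ∀ {x} → x ∈ I ⊕ v → x ∈ S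
    I⊕v⊆S {x} x∈I⊕v with ∈-⊕⁻ I v x∈I⊕v
    ... | inj₁ refl = v∈S
    ... | inj₂ x∈I  = proj₂ (proj₂ (∈-∖N⁻ S v (I⊆S′ x∈I)))
    I⊕v-indep : IsIndependent G (I ⊕ v)
    I⊕v-indep x y x∈ y∈ with ∈-⊕⁻ I v x∈ | ∈-⊕⁻ I v y∈
    ... | inj₁ refl | inj₁ refl = irrefl G
    ... | inj₁ refl | inj₂ y∈I  = ¬adj y∈I
    ... | inj₂ x∈I  | inj₁ refl = ¬adj x∈I ∘ Graph.sym G
    ... | inj₂ x∈I  | inj₂ y∈I  = I-indep x y x∈I y∈I

  -- every singleton is independent, so IndepWithin S 0 forces S to be empty
  indep-zero : ∀ S → IndepWithin S 0 → ∣ S ∣ ≡ 0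
  indep-zero S indep with nonempty? S
  ... | no  S=∅       = ∣Empty∣ S=∅
  ... | yes (v , v∈S) = contradiction (indep ⁅ v ⁆ (⁅⁆⊆ v∈S) ⁅v⁆-indep) (subst (λ k → ¬ k ≤ 0) (sym (∣⁅x⁆∣≡1 v)) λ ())
    where
    ⁅v⁆-indep : IsIndependent G ⁅ v ⁆
    ⁅v⁆-indep x y x∈ y∈ rewrite x∈⁅y⁆⇒x≡y v x∈ | x∈⁅y⁆⇒x≡y v y∈ = irrefl G

  -- Greedily remove the closed
  -- neighbourhood of a vertex of minimum degree and induct on a.
  degree-bound : ∀ a S → IndepWithin S a → ∣ S ∣ * ∣ S ∣ ≤ a * (degSum S + ∣ S ∣)
  degree-bound zero    S indep rewrite indep-zero S indep = z≤n
  degree-bound (suc a) S indep with nonempty? S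
  ... | no  S=∅ rewrite ∣Empty∣ S=∅ = z≤n
  ... | yes (v₀ , v₀∈S) with minimiser (deg S) S (deg S v₀) ≤-refl v₀∈S
  ... | v , v∈S , v-min =
    subst (λ s → s * s ≤ suc a * (degSum S + s)) (sym (∣∖N∣ S v v∈S))
      (greedy-step-arith a ∣ S ∖N[ v ] ∣ (degSum (S ∖N[ v ])) (degSum S) (deg S v)
        (degree-bound a (S ∖N[ v ]) (indep-∖N S v a v∈S indep))
        (degSum-∖N S v v∈S v-min))

module CliqueCounts {n : ℕ} (G : Graph n) where

  open DegreeBound G

  Clique : ℕ → Subset n → Set
  Clique i S = IsClique G S × ∣ S ∣ ≡ i

  clique? : ∀ i S → Dec (Clique i S)
  clique? i S = isClique? G S ×-dec (∣ S ∣ ℕ.≟ i)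

  κ : ℕ → Subset n → ℕ
  κ i S = ⟦ clique? i S ⟧

  t≡∑κ : ∀ i → t i G ≡ ∑ˢ n (κ i)
  t≡∑κ i = trans (length-filter-sum (clique? i) (allSubsets n)) (sumList-allSubsets n (κ i))

  clique-⊕⁻ : ∀ i L v → lookup L v ≡ false → Clique (suc i) (L ⊕ v) →
    Clique i L × (∀ u → u ∈ L → Adj G u v)
  clique-⊕⁻ i L v v∉L (cl , size) =
    ((λ x y x∈ y∈ → cl x y (∈-⊕⁺ L v x∈) (∈-⊕⁺ L v y∈)) , suc-injective (trans (sym (∣⊕∣ L v v∉L)) size)) ,
    λ u u∈L → cl u v (∈-⊕⁺ L v u∈L) (∈-⊕-here L v) (λ { refl → lookup⇒∉ v∉L u∈L })

  clique-⊕⁺ : ∀ i L v → lookup L v ≡ false → Clique i L → (∀ u → u ∈ L → Adj G u v) →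
    Clique (suc i) (L ⊕ v)
  clique-⊕⁺ i L v v∉L (cl , size) joined = cl⊕ , trans (∣⊕∣ L v v∉L) (cong suc size)
    where
    cl⊕ : IsClique G (L ⊕ v)
    cl⊕ x y x∈ y∈ x≢y with ∈-⊕⁻ L v x∈ | ∈-⊕⁻ L v y∈
    ... | inj₁ refl | inj₁ refl = contradiction refl x≢y
    ... | inj₁ refl | inj₂ y∈L  = Graph.sym G (joined y y∈L)
    ... | inj₂ x∈L  | inj₁ refl = joined x x∈L
    ... | inj₂ x∈L  | inj₂ y∈L  = cl x y x∈L y∈L x≢y

  -- ext i L: the vertices v ∉ L for which L ⊕ v is an (i+1)-clique; for an
  -- i-clique L this is the common neighbourhood of L
  ext : ℕ → Subset n → Subset n
  ext i L = tabulate (λ v → not (lookup L v) ∧ does (clique? (suc i) (L ⊕ v)))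

  lookup-ext : ∀ i L v → lookup (ext i L) v ≡ not (lookup L v) ∧ does (clique? (suc i) (L ⊕ v))
  lookup-ext i L v = lookup∘tabulate _ v

  χ∈-ext : ∀ i L v → χ∈ (ext i L) v ≡ χ∉ L v * κ (suc i) (L ⊕ v)
  χ∈-ext i L v = trans (cong bit (lookup-ext i L v)) (bit-not-∧-does (lookup L v) (clique? (suc i) (L ⊕ v)))

  -- only i-cliques have extensions
  χ∈-ext-κ : ∀ i L v → χ∈ (ext i L) v ≡ κ i L * χ∈ (ext i L) v
  χ∈-ext-κ i L v = trans (χ∈-ext i L v) (trans (extension-κ (lookup L v) refl) (cong (κ i L *_) (sym (χ∈-ext i L v))))
    where
    extension-κ : ∀ b → lookup L v ≡ b → bit (not b) * κ (suc i) (L ⊕ v) ≡ κ i L * (bit (not b) * κ (suc i) (L ⊕ v))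
    extension-κ true  _ = sym (*-zeroʳ (κ i L))
    extension-κ false v∉L with clique? (suc i) (L ⊕ v)
    ... | no _    = sym (*-zeroʳ (κ i L))
    ... | yes L⊕v with clique? i L
    ...   | yes _ = refl
    ...   | no ¬L = contradiction (proj₁ (clique-⊕⁻ i L v v∉L L⊕v)) ¬L

  ∑ext-κ : ∀ i L (f : Fin n → ℕ) →
    ∑[ v < n ] (χ∈ (ext i L) v * f v) ≡ κ i L * ∑[ v < n ] (χ∈ (ext i L) v * f v)
  ∑ext-κ i L f = begin
    ∑[ v < n ] (χ∈ (ext i L) v * f v)             ≡⟨ sum-cong-≗ (λ v → trans (cong (_* f v) (χ∈-ext-κ i L v)) (*-assoc (κ i L) _ (f v))) ⟩
    ∑[ v < n ] (κ i L * (χ∈ (ext i L) v * f v))   ≡⟨ *-distribˡ-sum (κ i L) (λ v → χ∈ (ext i L) v * f v) ⟨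
    κ i L * ∑[ v < n ] (χ∈ (ext i L) v * f v)     ∎
    where open ≡-Reasoning

  N : ℕ → Subset n → ℕ
  N i L = ∣ ext i L ∣

  N-as-sum : ∀ i L → N i L ≡ ∑[ v < n ] (χ∈ (ext i L) v * 1)
  N-as-sum i L = trans (∣∣≡∑χ∈ (ext i L)) (sum-cong-≗ (λ v → sym (*-identityʳ (χ∈ (ext i L) v))))

  N-κ : ∀ i L → N i L ≡ κ i L * N i L
  N-κ i L = trans (N-as-sum i L) (trans (∑ext-κ i L (λ _ → 1)) (cong (κ i L *_) (sym (N-as-sum i L))))

  T : ℕ → ℕ
  T i = ∑ˢ n (κ i)

  -- every (i+1)-clique K arises as L ⊕ v from exactly ∣ K ∣ = i + 1 pairs (L, v)
  ∑ˢ-ext : ∀ i (f : Subset n → ℕ) →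
    ∑ˢ n (λ L → ∑[ v < n ] (χ∈ (ext i L) v * f (L ⊕ v))) ≡ suc i * ∑ˢ n (λ K → κ (suc i) K * f K)
  ∑ˢ-ext i f = begin
    ∑ˢ n (λ L → ∑[ v < n ] (χ∈ (ext i L) v * f (L ⊕ v)))
      ≡⟨ ∑ˢ-cong n (λ L → sum-cong-≗ (λ v → trans (cong (_* f (L ⊕ v)) (χ∈-ext i L v)) (*-assoc (χ∉ L v) _ _))) ⟩
    ∑ˢ n (λ L → ∑[ v < n ] (χ∉ L v * (κ (suc i) (L ⊕ v) * f (L ⊕ v))))
      ≡⟨ double-count n (λ K → κ (suc i) K * f K) ⟩
    ∑ˢ n (λ K → ∣ K ∣ * (κ (suc i) K * f K))
      ≡⟨ ∑ˢ-cong n (λ K → size-κ K) ⟩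
    ∑ˢ n (λ K → suc i * (κ (suc i) K * f K))
      ≡⟨ ∑ˢ-distribˡ-* n (suc i) (λ K → κ (suc i) K * f K) ⟩
    suc i * ∑ˢ n (λ K → κ (suc i) K * f K) ∎
    where
    open ≡-Reasoning
    size-κ : ∀ K → ∣ K ∣ * (κ (suc i) K * f K) ≡ suc i * (κ (suc i) K * f K)
    size-κ K with clique? (suc i) K
    ... | yes (_ , size) = cong (_* (1 * f K)) size
    ... | no  _          = trans (*-zeroʳ ∣ K ∣) (sym (*-zeroʳ (suc i)))

  ∑ˢ-N : ∀ i → ∑ˢ n (N i) ≡ suc i * T (suc i)
  ∑ˢ-N i = begin
    ∑ˢ n (N i)                                               ≡⟨ ∑ˢ-cong n (N-as-sum i) ⟩
    ∑ˢ n (λ L → ∑[ v < n ] (χ∈ (ext i L) v * 1))             ≡⟨ ∑ˢ-ext i (λ _ → 1) ⟩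
    suc i * ∑ˢ n (λ K → κ (suc i) K * 1)                     ≡⟨ cong (suc i *_) (∑ˢ-cong n (λ K → *-identityʳ (κ (suc i) K))) ⟩
    suc i * T (suc i)                                        ∎
    where open ≡-Reasoning

  κ-⊕-⊕ : ∀ i L v w → lookup L v ≡ false → Clique (suc i) (L ⊕ v) → Clique i L →
    ¬ w ≡ v → lookup L w ≡ false →
    κ (suc (suc i)) ((L ⊕ v) ⊕ w) ≡ κ (suc i) (L ⊕ w) * χA v w
  κ-⊕-⊕ i L v w v∉L L⊕v-cl L-cl w≢v w∉L =
    trans (⟦⟧-⇔ to from (clique? (suc (suc i)) ((L ⊕ v) ⊕ w)) (clique? (suc i) (L ⊕ w) ×-dec adj? G v w))
          (⟦⟧-× (clique? (suc i) (L ⊕ w)) (adj? G v w))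
    where
    w∉L⊕v : lookup (L ⊕ v) w ≡ false
    w∉L⊕v = trans (⊕-there L w≢v) w∉L
    to : Clique (suc (suc i)) ((L ⊕ v) ⊕ w) → Clique (suc i) (L ⊕ w) × Adj G v w
    to cl with clique-⊕⁻ (suc i) (L ⊕ v) w w∉L⊕v cl
    ... | _ , joined = clique-⊕⁺ i L w w∉L L-cl (λ u u∈L → joined u (∈-⊕⁺ L v u∈L)) , joined v (∈-⊕-here L v)
    from : Clique (suc i) (L ⊕ w) × Adj G v w → Clique (suc (suc i)) ((L ⊕ v) ⊕ w)
    from (L⊕w-cl , v~w) = clique-⊕⁺ (suc i) (L ⊕ v) w w∉L⊕v L⊕v-cl joined
      where
      joined : ∀ u → u ∈ L ⊕ v → Adj G u w
      joined u u∈L⊕v with ∈-⊕⁻ L v u∈L⊕v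
      ... | inj₁ refl = v~w
      ... | inj₂ u∈L  = proj₂ (clique-⊕⁻ i L w w∉L L⊕w-cl) u u∈L

  χ∈-ext-⊕ : ∀ i L v w → Clique i L → lookup L v ≡ false → Clique (suc i) (L ⊕ v) →
    χ∈ (ext i L) w * χA v w ≡ χ∈ (ext (suc i) (L ⊕ v)) w
  χ∈-ext-⊕ i L v w L-cl v∉L L⊕v-cl rewrite χ∈-ext i L w | χ∈-ext (suc i) (L ⊕ v) w with w ≟ v
  ... | yes refl rewrite ⊕-here L w | v∉L with adj? G w w
  ...   | yes w~w = contradiction w~w (irrefl G)
  ...   | no  _   = *-zeroʳ (1 * κ (suc i) (L ⊕ w))
  χ∈-ext-⊕ i L v w L-cl v∉L L⊕v-cl | no w≢v rewrite ⊕-there L w≢v with lookup L w in w∉L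
  ... | true  = refl
  ... | false = trans (*-assoc 1 (κ (suc i) (L ⊕ w)) (χA v w))
                      (cong (1 *_) (sym (κ-⊕-⊕ i L v w v∉L L⊕v-cl L-cl w≢v w∉L)))

  deg-ext : ∀ i L v → Clique i L → lookup L v ≡ false → Clique (suc i) (L ⊕ v) →
    deg (ext i L) v ≡ N (suc i) (L ⊕ v)
  deg-ext i L v L-cl v∉L L⊕v-cl =
    trans (sum-cong-≗ (λ w → χ∈-ext-⊕ i L v w L-cl v∉L L⊕v-cl)) (sym (∣∣≡∑χ∈ (ext (suc i) (L ⊕ v))))

  degSum-ext : ∀ i L → Clique i L → degSum (ext i L) ≡ ∑[ v < n ] (χ∈ (ext i L) v * N (suc i) (L ⊕ v))
  degSum-ext i L L-cl = sum-cong-≗ extension-degree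
    where
    extension-degree : ∀ v → χ∈ (ext i L) v * deg (ext i L) v ≡ χ∈ (ext i L) v * N (suc i) (L ⊕ v)
    extension-degree v rewrite χ∈-ext i L v with lookup L v in v∉L | clique? (suc i) (L ⊕ v)
    ... | true  | _          = refl
    ... | false | no _       = refl
    ... | false | yes L⊕v-cl = cong (1 * 1 *_) (deg-ext i L v L-cl v∉L L⊕v-cl)

  κ-degSum-ext : ∀ i L → κ i L * degSum (ext i L) ≡ ∑[ v < n ] (χ∈ (ext i L) v * N (suc i) (L ⊕ v))
  κ-degSum-ext i L = trans clique-case (sym (∑ext-κ i L (N (suc i) ∘ (L ⊕_))))
    where
    clique-case : κ i L * degSum (ext i L) ≡ κ i L * ∑[ v < n ] (χ∈ (ext i L) v * N (suc i) (L ⊕ v))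
    clique-case with clique? i L
    ... | yes L-cl = cong (1 *_) (degSum-ext i L L-cl)
    ... | no  _    = refl

  ∑ˢ-degSum : ∀ i → ∑ˢ n (λ L → κ i L * degSum (ext i L)) ≡ suc i * (suc (suc i) * T (suc (suc i)))
  ∑ˢ-degSum i = begin
    ∑ˢ n (λ L → κ i L * degSum (ext i L))                        ≡⟨ ∑ˢ-cong n (κ-degSum-ext i) ⟩
    ∑ˢ n (λ L → ∑[ v < n ] (χ∈ (ext i L) v * N (suc i) (L ⊕ v)))  ≡⟨ ∑ˢ-ext i (N (suc i)) ⟩
    suc i * ∑ˢ n (λ K → κ (suc i) K * N (suc i) K)               ≡⟨ cong (suc i *_) (∑ˢ-cong n (λ K → sym (N-κ (suc i) K))) ⟩
    suc i * ∑ˢ n (N (suc i))                                     ≡⟨ cong (suc i *_) (∑ˢ-N (suc i)) ⟩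
    suc i * (suc (suc i) * T (suc (suc i)))                      ∎
    where open ≡-Reasoning

  local-bound : ∀ α → IndepNumberAtMost G α → ∀ i L →
    κ i L * (N i L * N i L) ≤ α * (κ i L * degSum (ext i L) + N i L)
  local-bound α α-bound i L with clique? i L
  ... | no  _ = z≤n
  ... | yes _ = subst₂ (λ x y → x ≤ α * (y + N i L)) (sym (*-identityˡ (N i L * N i L))) (sym (*-identityˡ (degSum (ext i L))))
                  (degree-bound α (ext i L) (λ I _ → α-bound I))

  clique-step : ∀ α → IndepNumberAtMost G α → ∀ i →
    (suc i * T (suc i)) * (suc i * T (suc i)) ≤
    T i * (α * (suc i * (suc (suc i) * T (suc (suc i))) + suc i * T (suc i)))
  clique-step α α-bound i = begin
    (suc i * T (suc i)) * (suc i * T (suc i))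
      ≡⟨ cong (λ x → x * x) (sym (trans (∑ˢ-cong n (λ L → sym (N-κ i L))) (∑ˢ-N i))) ⟩
    ∑ˢ n (λ L → κ i L * N i L) * ∑ˢ n (λ L → κ i L * N i L)
      ≤⟨ cauchy-schwarz n (κ i) (N i) ⟩
    T i * ∑ˢ n (λ L → κ i L * (N i L * N i L))
      ≤⟨ *-monoʳ-≤ (T i) (∑ˢ-mono n (local-bound α α-bound i)) ⟩
    T i * ∑ˢ n (λ L → α * (κ i L * degSum (ext i L) + N i L))
      ≡⟨ cong (T i *_) (∑ˢ-distribˡ-* n α (λ L → κ i L * degSum (ext i L) + N i L)) ⟩
    T i * (α * ∑ˢ n (λ L → κ i L * degSum (ext i L) + N i L))
      ≡⟨ cong (λ x → T i * (α * x)) (∑ˢ-distrib-+ n (λ L → κ i L * degSum (ext i L)) (N i)) ⟩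
    T i * (α * (∑ˢ n (λ L → κ i L * degSum (ext i L)) + ∑ˢ n (N i)))
      ≡⟨ cong (λ x → T i * (α * x)) (cong₂ _+_ (∑ˢ-degSum i) (∑ˢ-N i)) ⟩
    T i * (α * (suc i * (suc (suc i) * T (suc (suc i))) + suc i * T (suc i))) ∎
    where open ≤-Reasoning

  -- the empty set is the only 0-clique, and every vertex extends it
  N-empty : ∀ L → κ 0 L * N 0 L ≡ κ 0 L * n
  N-empty L with clique? 0 L
  ... | no  _ = refl
  ... | yes (L-cl , size) =
    cong (1 *_) (≤-antisym (∣p∣≤n (ext 0 L)) (subst (_≤ N 0 L) (∣⊤∣≡n n) (p⊆q⇒∣p∣≤∣q∣ {p = ⊤} (λ {v} _ → every v))))
    where
    outside-L : ∀ v → lookup L v ≡ false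
    outside-L v with lookup L v in v∈L
    ... | false = refl
    ... | true  = contradiction (subst (1 ≤_) size (∈⇒∣∣≥1 {S = L} (lookup⇒∈ v∈L))) λ ()
    singleton : ∀ v → Clique 1 (L ⊕ v)
    singleton v = clique-⊕⁺ 0 L v (outside-L v) (L-cl , size) (λ u u∈L → contradiction u∈L (lookup⇒∉ (outside-L u)))
    every : ∀ v → v ∈ ext 0 L
    every v = lookup⇒∈ (trans (lookup-ext 0 L v)
      (cong₂ _∧_ (cong not (outside-L v)) (dec-true (clique? 1 (L ⊕ v)) (singleton v))))

  clique-base : T 1 ≡ n * T 0
  clique-base = begin
    T 1                         ≡⟨ +-identityʳ (T 1) ⟨
    1 * T 1                     ≡⟨ ∑ˢ-N 0 ⟨
    ∑ˢ n (N 0)                  ≡⟨ ∑ˢ-cong n (λ L → trans (N-κ 0 L) (N-empty L)) ⟩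
    ∑ˢ n (λ L → κ 0 L * n)      ≡⟨ ∑ˢ-cong n (λ L → *-comm (κ 0 L) n) ⟩
    ∑ˢ n (λ L → n * κ 0 L)      ≡⟨ ∑ˢ-distribˡ-* n n (κ 0) ⟩
    n * T 0                     ∎
    where open ≡-Reasoning

-- With A = t_j, B = t_{j+1},
-- C = t_{j+2}, k = j + 1 and p = α^j: the hypothesis nA ≤ kp(B + A) and the
-- clique step (kB)² ≤ Aα(k(k+1)C + kB) give nB ≤ (k+1)(αp)(C + B).
ratio-step : ∀ n α p j A B C → 1 ≤ α →
  n * A ≤ (suc j * p) * (B + A) →
  (suc j * B) * (suc j * B) ≤ A * (α * (suc j * (suc (suc j) * C) + suc j * B)) →
  n * B ≤ (suc (suc j) * (α * p)) * (C + B)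
ratio-step n α p j zero B C α≥1 _ step =
  subst (λ b → n * b ≤ (suc (suc j) * (α * p)) * (C + b)) (sym B≡0)
    (subst (_≤ (suc (suc j) * (α * p)) * (C + 0)) (sym (*-zeroʳ n)) z≤n)
  where
  kB≥B : B ≤ suc j * B
  kB≥B = m≤n*m B (suc j)
  B≡0 : B ≡ 0
  B≡0 = n≤0⇒n≡0 (square-≤⁻¹ B 0 (≤-trans (*-mono-≤ kB≥B kB≥B) step))
ratio-step n α p j A@(suc _) B C α≥1 ih step = *-cancelˡ-≤ A (begin
  A * (n * B)                                   ≡⟨ swap A n B ⟩
  (n * A) * B                                   ≤⟨ *-monoˡ-≤ B ih ⟩
  (k * p) * (B + A) * B                         ≡⟨ expand k p A B ⟩
  p * (k * (B * B)) + k * p * A * B             ≤⟨ +-monoˡ-≤ (k * p * A * B) (*-monoʳ-≤ p step′) ⟩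
  p * (A * (α * (suc k * C + B))) + k * p * A * B
                                                ≤⟨ +-monoʳ-≤ (p * (A * (α * (suc k * C + B)))) (*-monoˡ-≤ B (*-monoˡ-≤ A (*-monoʳ-≤ k (m≤n*m p α)))) ⟩
  p * (A * (α * (suc k * C + B))) + k * (α * p) * A * B
                                                ≡⟨ collect p A α k C B ⟩
  A * ((suc k * (α * p)) * (C + B))             ∎)
  where
  open ≤-Reasoning
  k = suc j
  instance
    α-nonZero : NonZero α
    α-nonZero = >-nonZero α≥1
  step′ : k * (B * B) ≤ A * (α * (suc k * C + B))
  step′ = *-cancelˡ-≤ k (subst₂ _≤_ (squares k B) (factor A α k C B) step)
    where
    squares : ∀ k b → (k * b) * (k * b) ≡ k * (k * (b * b))
    squares = solve-∀
    factor : ∀ a α k c b → a * (α * (k * ((1 + k) * c) + k * b)) ≡ k * (a * (α * ((1 + k) * c + b)))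
    factor = solve-∀
  swap : ∀ a n b → a * (n * b) ≡ (n * a) * b
  swap = solve-∀
  expand : ∀ k p a b → (k * p) * (b + a) * b ≡ p * (k * (b * b)) + k * p * a * b
  expand = solve-∀
  collect : ∀ p a α k c b → p * (a * (α * ((1 + k) * c + b))) + k * (α * p) * a * b ≡ a * ((1 + k) * (α * p) * (c + b))
  collect = solve-∀

clique-ratio : ∀ {n} (G : Graph n) α → 1 ≤ α → IndepNumberAtMost G α → ∀ j →
  n * t j G ≤ (suc j * α ^ j) * (t (suc j) G + t j G)
clique-ratio {n} G α α≥1 α-bound j =
  subst₂ (λ x y → n * x ≤ (suc j * α ^ j) * (y + x)) (sym (t≡∑κ j)) (sym (t≡∑κ (suc j))) (T-ratio j)
  where
  open CliqueCounts G
  T-ratio : ∀ j → n * T j ≤ (suc j * α ^ j) * (T (suc j) + T j)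
  T-ratio zero = begin
    n * T 0          ≤⟨ m≤m+n (n * T 0) (T 0) ⟩
    n * T 0 + T 0    ≡⟨ cong (_+ T 0) clique-base ⟨
    T 1 + T 0        ≡⟨ *-identityˡ (T 1 + T 0) ⟨
    1 * (T 1 + T 0)  ∎
    where open ≤-Reasoning
  T-ratio (suc j) = ratio-step n α (α ^ j) j (T j) (T (suc j)) (T (suc (suc j))) α≥1
                      (T-ratio j) (clique-step α α-bound j)

-- m/d ≤ x/y + 1 is the cross-multiplied inequality m·y ≤ d·(x + y); the
-- comparison is made in the unnormalised rationals, where ≤ is cross-multiplication
frac-≤-frac+1 : ∀ m d x y → m * suc y ≤ suc d * (x + suc y) → (ℤ.+ m) / suc d ≤ℚ (ℤ.+ x) / suc y +ℚ 1ℚ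
frac-≤-frac+1 m d x y cross = ℚ.toℚᵘ-cancel-≤
  (ℚᵘ.≤-respˡ-≃ (ℚᵘ.≃-sym (ℚ.toℚᵘ-fromℚᵘ (mkℚᵘ (ℤ.+ m) d)))
    (ℚᵘ.≤-respʳ-≃ (ℚᵘ.≃-sym (ℚᵘ.≃-trans (ℚ.toℚᵘ-homo-+ ((ℤ.+ x) / suc y) 1ℚ)
                                         (ℚᵘ.+-cong (ℚ.toℚᵘ-fromℚᵘ (mkℚᵘ (ℤ.+ x) y)) (ℚ.toℚᵘ-fromℚᵘ 1ℚᵘ))))
      (*≤* (subst₂ ℤ._≤_ lhs rhs (ℤ.+≤+ cross′)))))
  where
  cross′ : m * (suc y * 1) ≤ (x * 1 + 1 * suc y) * suc d
  cross′ = subst₂ _≤_ (cong (m *_) (sym (*-identityʳ (suc y)))) (regroup x y d) cross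
    where
    regroup : ∀ x y d → suc d * (x + suc y) ≡ (x * 1 + 1 * suc y) * suc d
    regroup = solve-∀
  lhs : ℤ.+ (m * (suc y * 1)) ≡ ℤ.+ m ℤ.* ℤ.+ (suc y * 1)
  lhs = ℤ.pos-* m _
  rhs : ℤ.+ ((x * 1 + 1 * suc y) * suc d) ≡ (ℤ.+ x ℤ.* ℤ.+ 1 ℤ.+ ℤ.+ 1 ℤ.* ℤ.+ suc y) ℤ.* ℤ.+ suc d
  rhs = trans (ℤ.pos-* (x * 1 + 1 * suc y) (suc d))
          (cong (ℤ._* ℤ.+ suc d) (cong₂ ℤ._+_ (ℤ.pos-* x 1) (ℤ.pos-* 1 (suc y))))

frac-1≤frac : ∀ m d x y (d>0 : 0 < d) (y>0 : 0 < y) → m * y ≤ d * (x + y) → frac m d d>0 - 1ℚ ≤ℚ frac x y y>0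
frac-1≤frac m (suc d) x (suc y) (s≤s _) (s≤s _) cross =
  subst (_ ≤ℚ_) cancel (ℚ.+-monoˡ-≤ (- 1ℚ) (frac-≤-frac+1 m d x y cross))
  where
  q = (ℤ.+ x) / suc y
  cancel : (q +ℚ 1ℚ) +ℚ (- 1ℚ) ≡ q
  cancel = trans (ℚ.+-assoc q 1ℚ (- 1ℚ)) (trans (cong (q +ℚ_) (ℚ.+-inverseʳ 1ℚ)) (ℚ.+-identityʳ q))

-- Lemma 2.2: the case j = k − 2 of clique-ratio, divided out in ℚ.
lemma2p2 : ∀ {n} (G : Graph n) (α k : ℕ) → 1 ≤ α → 2 ≤ k →
    IndepNumberAtMost G α →
    (pos : 0 < t (k ∸ 1) G) → (den : 0 < k * α ^ (k ∸ 1)) →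
    frac (∣V∣ G) (k * α ^ (k ∸ 1)) den - 1ℚ ≤ℚ frac (t k G) (t (k ∸ 1) G) pos
lemma2p2 {n} G α (suc (suc j)) α≥1 (s≤s (s≤s z≤n)) α-bound pos den =
  frac-1≤frac n (suc (suc j) * α ^ suc j) (t (suc (suc j)) G) (t (suc j) G) den pos
    (clique-ratio G α α≥1 α-bound (suc j))
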